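{- Let $p$ be a prime, $n\ge1$, $F=\mathbb{F}_{p^n}$, and let $f\colon F\to F$ be a nonzero function with $d^\circ(f)\le p$. Then for any $a\in F^\times$ and $b\in F$, $\tilde N_f(a,b)$ equals either $0$ or $\tilde N_f(a,\tilde D_af(0))$. In particular, $f$ is a GAPN function if and only if $\tilde N_f(a,\tilde D_af(0))\le p$ for every $a\in F^\times$.
   Context: $\tilde D_af(x)=\sum_{j\in\mathbb{F}_p}f(x+ja)$, $\tilde N_f(a,b)=\#\{x\in F:\tilde D_af(x)=b\}$; $f$ is GAPN if $\tilde N_f(a,b)\le p$ for all $a\in F^\times$, $b\in F$. For $m\ge1$, $[f]^m(x_1,\dots,x_m)=\sum_{I\subseteq\{1,\dots,m\}}(-1)^{m-|I|}f\big(\sum_{k\in I}x_k\big)$, $[f]^0=f(0)$; for nonzero $f$, $d^\circ(f)$ is the largest $m\ge0$ with $[f]^m\not\equiv0$. -}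

module Defs where

open import Data.Nat using (ℕ; zero; suc; _≤_; _<_; _∸_; NonZero)
import Data.Nat as ℕ
open import Data.Nat.DivMod using (_mod_)
open import Data.Nat.Primality using (Prime; prime⇒nonZero)
open import Data.Bool using (Bool; true; false; if_then_else_)
open import Data.Fin using (Fin; toℕ) renaming (_≟_ to _≟ᶠ_)
open import Data.Vec using (Vec; []; _∷_; zipWith; replicate; map)
open import Data.Vec.Properties using (≡-dec)
open import Data.List using (List; []; _∷_; foldr; filter; length; concatMap; allFin)
import Data.List as L
open import Data.Product using (Σ; ∃; _×_; _,_)
open import Relation.Binary.PropositionalEquality using (_≡_; _≢_)
open import Relation.Nullary using (Dec; ¬_; does)
open import Relation.Binary using (DecidableEquality)

-- The finite field F = 𝔽_{p^n}, through its additive structure only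
-- (the only structure used by the definitions): F ≅ (ℤ/p)^n as an 𝔽_p-vector space.
module FF (p : ℕ) (pr : Prime p) (n : ℕ) where

  instance
    p-nonZero : NonZero p
    p-nonZero = prime⇒nonZero pr

  Fp : Set
  Fp = Fin p

  _+ₚ_ : Fp → Fp → Fp
  x +ₚ y = (toℕ x ℕ.+ toℕ y) mod p

  _*ₚ_ : Fp → Fp → Fp
  x *ₚ y = (toℕ x ℕ.* toℕ y) mod p

  -ₚ_ : Fp → Fp
  -ₚ x = (p ∸ toℕ x) mod p

  0ₚ : Fp
  0ₚ = 0 mod p

  F : Set
  F = Vec Fp n

  _+F_ : F → F → F
  _+F_ = zipWith _+ₚ_

  -F_ : F → F
  -F_ = map -ₚ_

  0F : F
  0F = replicate n 0ₚ

  _·F_ : Fp → F → F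
  j ·F a = map (j *ₚ_) a

  _≟F_ : DecidableEquality F
  _≟F_ = ≡-dec _≟ᶠ_

  ΣF : List F → F
  ΣF = foldr _+F_ 0F

  allVecs : (k : ℕ) → List (Vec Fp k)
  allVecs zero = [] ∷ []
  allVecs (suc k) = concatMap (λ x → L.map (x ∷_) (allVecs k)) (allFin p)

  allF : List F
  allF = allVecs n

  NonZeroF : F → Set
  NonZeroF a = a ≢ 0F

  D̃ : (F → F) → F → F → F
  D̃ f a x = ΣF (L.map (λ j → f (x +F (j ·F a))) (allFin p))

  Ñ : (F → F) → F → F → ℕ
  Ñ f a b = length (filter (λ x → D̃ f a x ≟F b) allF)

  IsGAPN : (F → F) → Set
  IsGAPN f = ∀ (a : F) → NonZeroF a → ∀ (b : F) → Ñ f a b ≤ p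

  -- subsets I ⊆ {1,…,m} as characteristic vectors
  allSubsets : (m : ℕ) → List (Vec Bool m)
  allSubsets zero = [] ∷ []
  allSubsets (suc m) = concatMap (λ b → L.map (b ∷_) (allSubsets m)) (true ∷ false ∷ [])

  card : ∀ {m} → Vec Bool m → ℕ
  card [] = 0
  card (true ∷ I) = suc (card I)
  card (false ∷ I) = card I

  sumOver : ∀ {m} → Vec Bool m → Vec F m → F
  sumOver [] [] = 0F
  sumOver (true ∷ I) (x ∷ xs) = x +F sumOver I xs
  sumOver (false ∷ I) (x ∷ xs) = sumOver I xs

  signF : ℕ → F → F
  signF zero y = y
  signF (suc e) y = -F (signF e y)

  bracket : (F → F) → (m : ℕ) → Vec F m → F
  bracket f m xs = ΣF (L.map (λ I → signF (m ∸ card I) (f (sumOver I xs))) (allSubsets m))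

  IsZeroFun : (F → F) → Set
  IsZeroFun f = ∀ x → f x ≡ 0F

  BracketVanishes : (F → F) → ℕ → Set
  BracketVanishes f m = ∀ (xs : Vec F m) → bracket f m xs ≡ 0F

  -- d°(f) ≤ d : the largest m with [f]^m ≢ 0 is ≤ d,
  -- i.e. [f]^m ≡ 0 for every m > d.
  DegLe : (F → F) → ℕ → Set
  DegLe f d = ∀ (m : ℕ) → d < m → BracketVanishes f m

module Submission where

-- In characteristic p every coefficient (-1)^{p-1+t} (p-1 choose t) of
-- the (p-1)-st difference Δ_a^{p-1} is 1, so D̃_a f(x) = Σ_{j ∈ 𝔽_p} f(x + j a)
-- equals Δ_a^{p-1} f(x).  The second differences of D̃_a f are therefore the
-- (p+1)-st differences [f]^{p+1}(y, x, a, …, a) of f, which vanish because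
-- d°(f) ≤ p: the map x ↦ D̃_a f(x) is affine.  A nonempty fibre E⁻¹(b) of an
-- affine map E on F is a translate of E⁻¹(E 0), and translation preserves the
-- number of elements of F satisfying a predicate.

open import Defs
open import Data.Nat using (ℕ; _≤_)
open import Data.Nat.Primality using (Prime)
open import Data.Sum using (_⊎_)
open import Data.Product using (_×_)
open import Relation.Nullary using (¬_)
open import Relation.Binary.PropositionalEquality using (_≡_)
open import Function.Bundles using (_⇔_)

open import Algebra.Bundles using (AbelianGroup)
open import Algebra.Core using (Op₁; Op₂)
open import Algebra.Structures using (IsAbelianGroup)
import Algebra.Properties.CommutativeMonoid.Sum
open import Data.Bool using (Bool; true; false)
open import Data.Fin using (Fin; toℕ) renaming (zero to fzero; suc to fsuc)
open import Data.Fin.Permutation using (Permutation; permutation)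
open import Data.Fin.Properties using (toℕ-injective; toℕ-fromℕ<; toℕ<n; toℕ-inject₁; toℕ-fromℕ)
open import Data.List using (List; []; _∷_; _++_; map; foldr; concatMap; tabulate; allFin; filter; length)
open import Data.List.Properties using (map-tabulate; map-++; ++-identityʳ; filter-none)
import Data.List.Properties as Listₚ
open import Data.List.Relation.Unary.Any using (any?; satisfied)
open import Data.List.Relation.Unary.All.Properties using (¬Any⇒All¬)
open import Data.Nat using (zero; suc; pred; z≤n; s≤s; z<s; s<s; _+_; _*_; _∸_; _<_; _%_; _!; nonTrivial⇒≢1)
open import Data.Nat.Combinatorics using (_C_; nCk≡n!/k![n-k]!; k![n∸k]!∣n!; nCk+nC[k+1]≡[n+1]C[k+1]; k>n⇒nCk≡0; nCn≡1)
open import Data.Nat.Divisibility using (_∣_; divides; ∣1⇒≡1; ∣⇒≤; m∣m*n)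
open import Data.Nat.DivMod using (_mod_; m/n*n≡m; %-distribˡ-+; %-distribˡ-*; m<n⇒m%n≡m; n%n≡0; m*n%n≡0)
open import Data.Nat.ListAction using (sum)
open import Data.Nat.ListAction.Properties using (sum-++)
open import Data.Nat.Primality using (euclidsLemma; prime⇒nonTrivial)
open import Data.Nat.Properties using (+-0-commutativeMonoid; +-comm; +-assoc; *-comm; +-suc; +-identityʳ; +-∸-assoc; suc-pred; m<m+n; ≤-pred; m≤n⇒m≤1+n; m+[n∸m]≡n; <⇒≤; <⇒≱; <-trans; n<1+n; ∸-monoʳ-<; _!*_!≢0)
open import Data.Product using (_,_)
open import Data.Sum using (inj₁; inj₂)
open import Data.Vec using (Vec; []; _∷_; zipWith; replicate)
import Data.Vec as Vec
import Data.Vec.Properties as Vecₚ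
import Data.Vec.Functional as Vector
open import Function.Bundles using (mk⇔)
open import Level using (0ℓ)
open import Relation.Binary.PropositionalEquality using (refl; sym; trans; cong; cong₂; subst; isEquivalence; module ≡-Reasoning)
open import Relation.Nullary using (yes; no; does; contradiction)
open import Relation.Nullary.Decidable using (does-⇔)
open import Relation.Unary using (Decidable)

isAbelianGroup-≡ : {A : Set} {_∙_ : Op₂ A} {ε : A} {_⁻¹ : Op₁ A} →
  (∀ x y z → (x ∙ y) ∙ z ≡ x ∙ (y ∙ z)) → (∀ x y → x ∙ y ≡ y ∙ x) →
  (∀ x → ε ∙ x ≡ x) → (∀ x → x ∙ (x ⁻¹) ≡ ε) → IsAbelianGroup _≡_ _∙_ ε _⁻¹
isAbelianGroup-≡ {_∙_ = _∙_} {ε} {_⁻¹} assoc comm idˡ invʳ = record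
  { isGroup = record
    { isMonoid = record
      { isSemigroup = record
        { isMagma = record { isEquivalence = isEquivalence ; ∙-cong = cong₂ _∙_ }
        ; assoc = assoc }
      ; identity = idˡ , λ x → trans (comm x ε) (idˡ x) }
    ; inverse = (λ x → trans (comm (x ⁻¹) x) (invʳ x)) , invʳ
    ; ⁻¹-cong = cong _⁻¹ }
  ; comm = comm }

vecIsAbelianGroup : {A : Set} {_∙_ : Op₂ A} {ε : A} {_⁻¹ : Op₁ A} →
  IsAbelianGroup _≡_ _∙_ ε _⁻¹ →
  ∀ k → IsAbelianGroup _≡_ (zipWith {n = k} _∙_) (replicate k ε) (Vec.map _⁻¹)
vecIsAbelianGroup G k = isAbelianGroup-≡
  (Vecₚ.zipWith-assoc assoc) (Vecₚ.zipWith-comm comm)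
  (Vecₚ.zipWith-identityˡ identityˡ) (Vecₚ.zipWith-inverseʳ inverseʳ)
  where open IsAbelianGroup G

foldr-allFin : {A B : Set} (f : A → B → B) (e : B) (N : ℕ) (h : Fin N → A) →
  foldr f e (map h (allFin N)) ≡ Vector.foldr f e h
foldr-allFin f e N h = trans (cong (foldr f e) (map-tabulate (λ i → i) h)) (foldr-tabulate N h)
  where
  foldr-tabulate : ∀ N (g : Fin N → _) → foldr f e (tabulate g) ≡ Vector.foldr f e g
  foldr-tabulate zero g = refl
  foldr-tabulate (suc N) g = cong (f (g fzero)) (foldr-tabulate N (λ i → g (fsuc i)))

sum-concatMap : {A : Set} (g : A → List ℕ) (xs : List A) →
  sum (concatMap g xs) ≡ sum (map (λ x → sum (g x)) xs)
sum-concatMap g [] = refl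
sum-concatMap g (x ∷ xs) = trans (sum-++ (g x) (concatMap g xs)) (cong (sum (g x) +_) (sum-concatMap g xs))

indicator : Bool → ℕ
indicator true = 1
indicator false = 0

length-filter : {A : Set} {P : A → Set} (P? : Decidable P) (xs : List A) →
  length (filter P? xs) ≡ sum (map (λ x → indicator (does (P? x))) xs)
length-filter P? [] = refl
length-filter P? (x ∷ xs) with does (P? x)
... | true = cong suc (length-filter P? xs)
... | false = length-filter P? xs

-- For a prime p, p ∤ m! when m < p, and hence p ∣ (p choose s) when 0 < s < p:
-- the latter is why all binomial coefficients in the expansion of the
-- (p-1)-st difference collapse to 1 in characteristic p.
prime∤factorial : ∀ {p} → Prime p → ∀ m → m < p → ¬ (p ∣ m !)
prime∤factorial pr zero _ p∣1 = nonTrivial⇒≢1 {{prime⇒nonTrivial pr}} (∣1⇒≡1 p∣1)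
prime∤factorial pr (suc m) m<p p∣m! with euclidsLemma (suc m) (m !) pr p∣m!
... | inj₁ p∣1+m = <⇒≱ m<p (∣⇒≤ p∣1+m)
... | inj₂ p∣m!′ = prime∤factorial pr m (<-trans (n<1+n m) m<p) p∣m!′

choose*factorials : ∀ n k → k ≤ n → (n C k) * (k ! * (n ∸ k) !) ≡ n !
choose*factorials n k k≤n = trans (cong (_* (k ! * (n ∸ k) !)) (nCk≡n!/k![n-k]! k≤n))
                                  (m/n*n≡m {{k !* (n ∸ k) !≢0}} (k![n∸k]!∣n! k≤n))

prime∣choose : ∀ {p} → Prime p → ∀ s → 0 < s → s < p → p ∣ p C s
prime∣choose {p@(suc p-1)} pr s 0<s s<p with euclidsLemma (p C s) (s ! * (p ∸ s) !) pr p∣product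
  where
  -- p ∣ p! = p · (p-1)!
  p∣product : p ∣ (p C s) * (s ! * (p ∸ s) !)
  p∣product = subst (p ∣_) (sym (choose*factorials p s (<⇒≤ s<p))) (m∣m*n (p-1 !))
... | inj₁ p∣choose = p∣choose
... | inj₂ p∣factorials with euclidsLemma (s !) ((p ∸ s) !) pr p∣factorials
...   | inj₁ p∣s! = contradiction p∣s! (prime∤factorial pr s s<p)
...   | inj₂ p∣[p-s]! = contradiction p∣[p-s]! (prime∤factorial pr (p ∸ s) (∸-monoʳ-< 0<s (<⇒≤ s<p)))

module Development (p : ℕ) (pr : Prime p) (n : ℕ) where
  open FF p pr n

  -- Arithmetic in 𝔽_p through the reduction map ⟦_⟧ : ℕ → 𝔽_p, a surjective
  -- homomorphism for + and *; every law of 𝔽_p is inherited from ℕ.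
  ⟦_⟧ : ℕ → Fp
  ⟦ m ⟧ = m mod p

  toℕ-⟦⟧ : ∀ m → toℕ ⟦ m ⟧ ≡ m % p
  toℕ-⟦⟧ m = toℕ-fromℕ< _

  ⟦⟧-toℕ : ∀ x → ⟦ toℕ x ⟧ ≡ x
  ⟦⟧-toℕ x = toℕ-injective (trans (toℕ-⟦⟧ (toℕ x)) (m<n⇒m%n≡m (toℕ<n x)))

  ⟦⟧-cong : ∀ {m k} → m % p ≡ k % p → ⟦ m ⟧ ≡ ⟦ k ⟧
  ⟦⟧-cong {m} {k} e = toℕ-injective (trans (toℕ-⟦⟧ m) (trans e (sym (toℕ-⟦⟧ k))))

  ⟦⟧-+ : ∀ m k → ⟦ m ⟧ +ₚ ⟦ k ⟧ ≡ ⟦ m + k ⟧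
  ⟦⟧-+ m k = ⟦⟧-cong (trans (cong₂ (λ u v → (u + v) % p) (toℕ-⟦⟧ m) (toℕ-⟦⟧ k))
                            (sym (%-distribˡ-+ m k p)))

  ⟦⟧-* : ∀ m k → ⟦ m ⟧ *ₚ ⟦ k ⟧ ≡ ⟦ m * k ⟧
  ⟦⟧-* m k = ⟦⟧-cong (trans (cong₂ (λ u v → (u * v) % p) (toℕ-⟦⟧ m) (toℕ-⟦⟧ k))
                            (sym (%-distribˡ-* m k p)))

  ⟦p⟧≡⟦0⟧ : ⟦ p ⟧ ≡ ⟦ 0 ⟧
  ⟦p⟧≡⟦0⟧ = ⟦⟧-cong (trans (n%n≡0 p) (sym (m*n%n≡0 0 p)))

  +ₚ-comm : ∀ x y → x +ₚ y ≡ y +ₚ x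
  +ₚ-comm x y = cong ⟦_⟧ (+-comm (toℕ x) (toℕ y))

  +ₚ-assoc : ∀ x y z → (x +ₚ y) +ₚ z ≡ x +ₚ (y +ₚ z)
  +ₚ-assoc x y z = begin
    ⟦ x′ + y′ ⟧ +ₚ z       ≡⟨ cong (⟦ x′ + y′ ⟧ +ₚ_) (sym (⟦⟧-toℕ z)) ⟩
    ⟦ x′ + y′ ⟧ +ₚ ⟦ z′ ⟧  ≡⟨ ⟦⟧-+ (x′ + y′) z′ ⟩
    ⟦ x′ + y′ + z′ ⟧       ≡⟨ cong ⟦_⟧ (+-assoc x′ y′ z′) ⟩
    ⟦ x′ + (y′ + z′) ⟧     ≡⟨ sym (⟦⟧-+ x′ (y′ + z′)) ⟩
    ⟦ x′ ⟧ +ₚ ⟦ y′ + z′ ⟧  ≡⟨ cong (_+ₚ ⟦ y′ + z′ ⟧) (⟦⟧-toℕ x) ⟩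
    x +ₚ (y +ₚ z)          ∎
    where
    open ≡-Reasoning
    x′ = toℕ x; y′ = toℕ y; z′ = toℕ z

  +ₚ-identityˡ : ∀ x → 0ₚ +ₚ x ≡ x
  +ₚ-identityˡ x = trans (cong (0ₚ +ₚ_) (sym (⟦⟧-toℕ x))) (trans (⟦⟧-+ 0 (toℕ x)) (⟦⟧-toℕ x))

  +ₚ-inverseʳ : ∀ x → x +ₚ (-ₚ x) ≡ 0ₚ
  +ₚ-inverseʳ x = begin
    x +ₚ ⟦ p ∸ x′ ⟧       ≡⟨ cong (_+ₚ ⟦ p ∸ x′ ⟧) (sym (⟦⟧-toℕ x)) ⟩
    ⟦ x′ ⟧ +ₚ ⟦ p ∸ x′ ⟧  ≡⟨ ⟦⟧-+ x′ (p ∸ x′) ⟩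
    ⟦ x′ + (p ∸ x′) ⟧     ≡⟨ cong ⟦_⟧ (m+[n∸m]≡n (<⇒≤ (toℕ<n x))) ⟩
    ⟦ p ⟧                 ≡⟨ ⟦p⟧≡⟦0⟧ ⟩
    0ₚ                    ∎
    where
    open ≡-Reasoning
    x′ = toℕ x

  *ₚ-suc : ∀ m x → ⟦ suc m ⟧ *ₚ x ≡ x +ₚ (⟦ m ⟧ *ₚ x)
  *ₚ-suc m x = begin
    ⟦ suc m ⟧ *ₚ x             ≡⟨ cong (⟦ suc m ⟧ *ₚ_) (sym (⟦⟧-toℕ x)) ⟩
    ⟦ suc m ⟧ *ₚ ⟦ x′ ⟧        ≡⟨ ⟦⟧-* (suc m) x′ ⟩
    ⟦ x′ + m * x′ ⟧            ≡⟨ sym (⟦⟧-+ x′ (m * x′)) ⟩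
    ⟦ x′ ⟧ +ₚ ⟦ m * x′ ⟧       ≡⟨ cong₂ _+ₚ_ (⟦⟧-toℕ x) (sym (⟦⟧-* m x′)) ⟩
    x +ₚ (⟦ m ⟧ *ₚ ⟦ x′ ⟧)     ≡⟨ cong (λ y → x +ₚ (⟦ m ⟧ *ₚ y)) (⟦⟧-toℕ x) ⟩
    x +ₚ (⟦ m ⟧ *ₚ x)          ∎
    where
    open ≡-Reasoning
    x′ = toℕ x

  *ₚ-zero : ∀ x → ⟦ 0 ⟧ *ₚ x ≡ 0ₚ
  *ₚ-zero x = trans (cong (⟦ 0 ⟧ *ₚ_) (sym (⟦⟧-toℕ x))) (⟦⟧-* 0 (toℕ x))

  Fp-isAbelianGroup : IsAbelianGroup _≡_ _+ₚ_ 0ₚ -ₚ_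
  Fp-isAbelianGroup = isAbelianGroup-≡ +ₚ-assoc +ₚ-comm +ₚ-identityˡ +ₚ-inverseʳ

  Fp-abelianGroup : AbelianGroup 0ℓ 0ℓ
  Fp-abelianGroup = record { isAbelianGroup = Fp-isAbelianGroup }

  F-abelianGroup : AbelianGroup 0ℓ 0ℓ
  F-abelianGroup = record { isAbelianGroup = vecIsAbelianGroup Fp-isAbelianGroup n }

  open AbelianGroup F-abelianGroup using (_-_; identityˡ; identityʳ; assoc; monoid; group; commutativeMonoid; commutativeSemigroup)
  open import Algebra.Properties.AbelianGroup F-abelianGroup using (⁻¹-∙-comm)
  open import Algebra.Properties.Group group using (ε⁻¹≈ε; ⁻¹-involutive; x∙y⁻¹≈ε⇒x≈y; x≈y⇒x∙y⁻¹≈ε)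
  open import Algebra.Properties.CommutativeSemigroup commutativeSemigroup using (x∙yz≈y∙xz; xy∙z≈y∙xz)
  open import Algebra.Properties.Monoid.Mult monoid using (×-homo-+; ×-assocˡ)
    renaming (_×_ to _⋆_)
  open import Algebra.Properties.CommutativeMonoid.Sum commutativeMonoid using (sum-cong-≗; ∑-distrib-+; sum-init-last)
    renaming (sum to ∑)

  ·F-suc : ∀ {k} m (a : Vec Fp k) → Vec.map (⟦ suc m ⟧ *ₚ_) a ≡ zipWith _+ₚ_ a (Vec.map (⟦ m ⟧ *ₚ_) a)
  ·F-suc m [] = refl
  ·F-suc m (x ∷ a) = cong₂ _∷_ (*ₚ-suc m x) (·F-suc m a)

  ⟦⟧-·F : ∀ m a → ⟦ m ⟧ ·F a ≡ m ⋆ a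
  ⟦⟧-·F zero a = trans (Vecₚ.map-cong *ₚ-zero a) (Vecₚ.map-const a 0ₚ)
  ⟦⟧-·F (suc m) a = trans (·F-suc m a) (cong (a +F_) (⟦⟧-·F m a))

  ·F-as-⋆ : ∀ j a → j ·F a ≡ toℕ j ⋆ a
  ·F-as-⋆ j a = trans (cong (_·F a) (sym (⟦⟧-toℕ j))) (⟦⟧-·F (toℕ j) a)

  p⋆≡0 : ∀ a → p ⋆ a ≡ 0F
  p⋆≡0 a = trans (sym (⟦⟧-·F p a)) (trans (cong (_·F a) ⟦p⟧≡⟦0⟧) (⟦⟧-·F 0 a))

  multiple⋆≡0 : ∀ {m} a → p ∣ m → m ⋆ a ≡ 0F
  multiple⋆≡0 a (divides k refl) = begin
    (k * p) ⋆ a   ≡⟨ cong (_⋆ a) (*-comm k p) ⟩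
    (p * k) ⋆ a   ≡⟨ sym (×-assocˡ a p k) ⟩
    p ⋆ (k ⋆ a)   ≡⟨ p⋆≡0 (k ⋆ a) ⟩
    0F            ∎
    where open ≡-Reasoning

  signF-involutive : ∀ e y → signF (suc (suc e)) y ≡ signF e y
  signF-involutive e y = ⁻¹-involutive (signF e y)

  signF-+ : ∀ e u v → signF e (u +F v) ≡ signF e u +F signF e v
  signF-+ zero u v = refl
  signF-+ (suc e) u v = trans (cong -F_ (signF-+ e u v)) (sym (⁻¹-∙-comm _ _))

  signF-0 : ∀ e → signF e 0F ≡ 0F
  signF-0 zero = refl
  signF-0 (suc e) = trans (cong -F_ (signF-0 e)) ε⁻¹≈ε

  signF-even : ∀ k y → signF (k + k) y ≡ y
  signF-even zero y = refl
  signF-even (suc k) y = trans (cong (λ e → signF (suc e) y) (+-suc k k))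
                               (trans (signF-involutive (k + k) y) (signF-even k y))

  ΣF-++ : ∀ xs ys → ΣF (xs ++ ys) ≡ ΣF xs +F ΣF ys
  ΣF-++ [] ys = sym (identityˡ _)
  ΣF-++ (x ∷ xs) ys = trans (cong (x +F_) (ΣF-++ xs ys)) (sym (assoc _ _ _))

  ΣF-neg : {B : Set} (g : B → F) (xs : List B) → ΣF (map (λ b → -F g b) xs) ≡ -F ΣF (map g xs)
  ΣF-neg g [] = sym ε⁻¹≈ε
  ΣF-neg g (x ∷ xs) = trans (cong ((-F g x) +F_) (ΣF-neg g xs)) (⁻¹-∙-comm _ _)

  Δ : F → (F → F) → F → F
  Δ u g w = g (u +F w) - g w

  Δs : ∀ {m} → Vec F m → (F → F) → F → F
  Δs [] g = g
  Δs (u ∷ us) g = Δ u (Δs us g)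

  Δ-cong : ∀ u {g h : F → F} → (∀ w → g w ≡ h w) → ∀ w → Δ u g w ≡ Δ u h w
  Δ-cong u g≗h w = cong₂ _-_ (g≗h (u +F w)) (g≗h w)

  Δs-translate : ∀ {m} (us : Vec F m) g c w → Δs us (λ y → g (c +F y)) w ≡ Δs us g (c +F w)
  Δs-translate [] g c w = refl
  Δs-translate (u ∷ us) g c w =
    cong₂ _-_ (trans (Δs-translate us g c (u +F w)) (cong (Δs us g) (x∙yz≈y∙xz c u w)))
              (Δs-translate us g c w)

  -- |I| ≤ m, so (-1)^{m+1-|I|} = -(-1)^{m-|I|} for I ⊆ {1,…,m}.
  card≤ : ∀ {m} (I : Vec Bool m) → card I ≤ m
  card≤ [] = z≤n
  card≤ (true ∷ I) = s≤s (card≤ I)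
  card≤ (false ∷ I) = m≤n⇒m≤1+n (card≤ I)

  -- Splitting the subsets of {1,…,m+1} according to whether they contain 1:
  -- [f]^{m+1}(x, xs) = [f(x + ·)]^m(xs) - [f]^m(xs).
  bracket-suc : ∀ f m x xs →
    bracket f (suc m) (x ∷ xs) ≡ bracket (λ y → f (x +F y)) m xs - bracket f m xs
  bracket-suc f m x xs = begin
    ΣF (map T (map (true ∷_) S ++ (map (false ∷_) S ++ [])))
      ≡⟨ cong (λ Is → ΣF (map T (map (true ∷_) S ++ Is))) (++-identityʳ _) ⟩
    ΣF (map T (map (true ∷_) S ++ map (false ∷_) S))
      ≡⟨ cong ΣF (map-++ T (map (true ∷_) S) (map (false ∷_) S)) ⟩
    ΣF (map T (map (true ∷_) S) ++ map T (map (false ∷_) S))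
      ≡⟨ ΣF-++ (map T (map (true ∷_) S)) (map T (map (false ∷_) S)) ⟩
    ΣF (map T (map (true ∷_) S)) +F ΣF (map T (map (false ∷_) S))
      ≡⟨ cong₂ _+F_ (cong ΣF (sym (Listₚ.map-∘ S)))
                    (cong ΣF (trans (sym (Listₚ.map-∘ S)) (Listₚ.map-cong drop-first S))) ⟩
    bracket (λ y → f (x +F y)) m xs +F ΣF (map (λ I → -F U I) S)
      ≡⟨ cong (bracket (λ y → f (x +F y)) m xs +F_) (ΣF-neg U S) ⟩
    bracket (λ y → f (x +F y)) m xs - bracket f m xs ∎
    where
    open ≡-Reasoning
    S = allSubsets m
    T : Vec Bool (suc m) → F
    T I = signF (suc m ∸ card I) (f (sumOver I (x ∷ xs)))
    U : Vec Bool m → F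
    U I = signF (m ∸ card I) (f (sumOver I xs))
    drop-first : ∀ I → T (false ∷ I) ≡ -F U I
    drop-first I = cong (λ e → signF e (f (sumOver I xs))) (+-∸-assoc 1 (card≤ I))

  bracket≡Δs : ∀ f m us → bracket f m us ≡ Δs us f 0F
  bracket≡Δs f zero [] = identityʳ (f 0F)
  bracket≡Δs f (suc m) (u ∷ us) = trans (bracket-suc f m u us)
    (cong₂ _-_ (trans (bracket≡Δs (λ y → f (u +F y)) m us) (Δs-translate us f u 0F))
               (bracket≡Δs f m us))

  ∑< : ℕ → (ℕ → F) → F
  ∑< N G = ∑ (λ (t : Fin N) → G (toℕ t))

  ∑<-cong : ∀ N {G H : ℕ → F} → (∀ t → t < N → G t ≡ H t) → ∑< N G ≡ ∑< N H
  ∑<-cong N G≡H = sum-cong-≗ {N} (λ t → G≡H (toℕ t) (toℕ<n t))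

  ∑<-snoc : ∀ N G → ∑< (suc N) G ≡ ∑< N G +F G N
  ∑<-snoc N G = trans (sum-init-last {N} (λ t → G (toℕ t)))
    (cong₂ _+F_ (sum-cong-≗ {N} (λ t → cong G (toℕ-inject₁ t))) (cong G (toℕ-fromℕ N)))

  ∑<-neg : ∀ N G → ∑< N (λ t → -F G t) ≡ -F ∑< N G
  ∑<-neg zero G = sym ε⁻¹≈ε
  ∑<-neg (suc N) G = trans (cong ((-F G 0) +F_) (∑<-neg N (λ t → G (suc t)))) (⁻¹-∙-comm _ _)

  ∑<-- : ∀ N G H → ∑< N (λ t → G t - H t) ≡ ∑< N G - ∑< N H
  ∑<-- N G H = trans (∑-distrib-+ {N} (λ t → G (toℕ t)) (λ t → -F H (toℕ t)))
                     (cong (∑< N G +F_) (∑<-neg N H))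

  -- The coefficient (-1)^{k+t} (k choose t) of g(w + t a) in Δ_a^k g(w).
  coeff : ℕ → ℕ → F → F
  coeff k t y = signF (k + t) ((k C t) ⋆ y)

  coeff-pascal : ∀ k t y → coeff (suc k) (suc t) y ≡ coeff k t y - coeff k (suc t) y
  coeff-pascal k t y = begin
    signF (suc k + suc t) ((suc k C suc t) ⋆ y)
      ≡⟨ cong₂ (λ e c → signF e (c ⋆ y)) (cong suc (+-suc k t)) (sym (nCk+nC[k+1]≡[n+1]C[k+1] k t)) ⟩
    signF (suc (suc (k + t))) ((k C t + k C suc t) ⋆ y)
      ≡⟨ signF-involutive (k + t) _ ⟩
    signF (k + t) ((k C t + k C suc t) ⋆ y)
      ≡⟨ cong (signF (k + t)) (×-homo-+ y (k C t) (k C suc t)) ⟩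
    signF (k + t) (((k C t) ⋆ y) +F ((k C suc t) ⋆ y))
      ≡⟨ signF-+ (k + t) _ _ ⟩
    coeff k t y +F signF (k + t) ((k C suc t) ⋆ y)
      ≡⟨ cong (coeff k t y +F_) (sym (⁻¹-involutive _)) ⟩
    coeff k t y - signF (suc (k + t)) ((k C suc t) ⋆ y)
      ≡⟨ cong (λ e → coeff k t y - signF e ((k C suc t) ⋆ y)) (sym (+-suc k t)) ⟩
    coeff k t y - coeff k (suc t) y ∎
    where open ≡-Reasoning

  coeff-beyond : ∀ k y → coeff k (suc k) y ≡ 0F
  coeff-beyond k y = trans (cong (λ c → signF (k + suc k) (c ⋆ y)) (k>n⇒nCk≡0 (n<1+n k)))
                           (signF-0 (k + suc k))

  coeff-diagonal : ∀ k y → coeff k k y ≡ y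
  coeff-diagonal k y = trans (cong (λ c → signF (k + k) (c ⋆ y)) (nCn≡1 k))
                             (trans (signF-even k (y +F 0F)) (identityʳ y))

  Δs-replicate : ∀ a g k w →
    Δs (replicate k a) g w ≡ ∑< (suc k) (λ t → coeff k t (g (w +F (t ⋆ a))))
  Δs-replicate a g zero w = sym (trans (identityʳ _) (trans (identityʳ _) (cong g (identityʳ w))))
  Δs-replicate a g (suc k) w = begin
    Δs (replicate k a) g (a +F w) - Δs (replicate k a) g w
      ≡⟨ cong₂ _-_ (Δs-replicate a g k (a +F w)) (Δs-replicate a g k w) ⟩
    ∑< (suc k) (λ t → coeff k t (g ((a +F w) +F (t ⋆ a)))) - ∑< (suc k) (λ t → coeff k t (G t))
      ≡⟨ cong₂ _-_ shift split-first ⟩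
    ∑< (suc k) A - (coeff k 0 (G 0) +F ∑< (suc k) X)
      ≡⟨ cong (∑< (suc k) A +F_) (sym (⁻¹-∙-comm _ _)) ⟩
    ∑< (suc k) A +F ((-F coeff k 0 (G 0)) +F (-F ∑< (suc k) X))
      ≡⟨ x∙yz≈y∙xz _ _ _ ⟩
    (-F coeff k 0 (G 0)) +F (∑< (suc k) A - ∑< (suc k) X)
      ≡⟨ cong ((-F coeff k 0 (G 0)) +F_) (sym (∑<-- (suc k) A X)) ⟩
    (-F coeff k 0 (G 0)) +F ∑< (suc k) (λ t → A t - X t)
      ≡⟨ cong ((-F coeff k 0 (G 0)) +F_) (∑<-cong (suc k) (λ t _ → sym (coeff-pascal k t (G (suc t))))) ⟩
    ∑< (suc (suc k)) (λ t → coeff (suc k) t (G t)) ∎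
    where
    open ≡-Reasoning
    G A X : ℕ → F
    G t = g (w +F (t ⋆ a))
    A t = coeff k t (G (suc t))
    X t = coeff k (suc t) (G (suc t))
    shift : ∑< (suc k) (λ t → coeff k t (g ((a +F w) +F (t ⋆ a)))) ≡ ∑< (suc k) A
    shift = ∑<-cong (suc k) (λ t _ → cong (λ z → coeff k t (g z)) (xy∙z≈y∙xz a w (t ⋆ a)))
    split-first : ∑< (suc k) (λ t → coeff k t (G t)) ≡ coeff k 0 (G 0) +F ∑< (suc k) X
    split-first = cong (coeff k 0 (G 0) +F_) (sym (trans (∑<-snoc k X)
                    (trans (cong (∑< k X +F_) (coeff-beyond k (G (suc k)))) (identityʳ _))))

  q : ℕ
  q = pred p

  p≡1+q : p ≡ suc q
  p≡1+q = sym (suc-pred p)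

  -- p ∣ (p choose s) for 0 < s < p kills the middle coefficients of Δ_a^p.
  coeff-p-vanishes : ∀ s y → 0 < s → s < p → coeff p s y ≡ 0F
  coeff-p-vanishes s y 0<s s<p =
    trans (cong (signF (p + s)) (multiple⋆≡0 y (prime∣choose pr s 0<s s<p))) (signF-0 (p + s))

  -- Pascal's rule at row p then makes row p - 1 constant,
  coeff-step : ∀ t y → t < q → coeff q t y ≡ coeff q (suc t) y
  coeff-step t y t<q = x∙y⁻¹≈ε⇒x≈y _ _ (begin
    coeff q t y - coeff q (suc t) y  ≡⟨ sym (coeff-pascal q t y) ⟩
    coeff (suc q) (suc t) y          ≡⟨ cong (λ r → coeff r (suc t) y) (sym p≡1+q) ⟩
    coeff p (suc t) y                ≡⟨ coeff-p-vanishes (suc t) y z<s (subst (suc t <_) (sym p≡1+q) (s<s t<q)) ⟩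
    0F                               ∎)
    where open ≡-Reasoning

  -- and its value is the diagonal coefficient 1.
  coeff-one : ∀ t y → t ≤ q → coeff q t y ≡ y
  coeff-one t y t≤q = from-top (q ∸ t) t (m+[n∸m]≡n t≤q)
    where
    from-top : ∀ d t → t + d ≡ q → coeff q t y ≡ y
    from-top zero t t+0≡q = trans (cong (λ r → coeff q r y) (trans (sym (+-identityʳ t)) t+0≡q))
                                  (coeff-diagonal q y)
    from-top (suc d) t t+1+d≡q = trans (coeff-step t y (subst (t <_) t+1+d≡q (m<m+n t z<s)))
                                       (from-top d (suc t) (trans (sym (+-suc t d)) t+1+d≡q))

  D̃≡Δs : ∀ g a w → D̃ g a w ≡ Δs (replicate q a) g w
  D̃≡Δs g a w = begin
    ΣF (map (λ j → g (w +F (j ·F a))) (allFin p))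
      ≡⟨ foldr-allFin _+F_ 0F p (λ j → g (w +F (j ·F a))) ⟩
    ∑ (λ j → g (w +F (j ·F a)))
      ≡⟨ sum-cong-≗ {p} (λ j → cong (λ z → g (w +F z)) (·F-as-⋆ j a)) ⟩
    ∑< p (λ t → g (w +F (t ⋆ a)))
      ≡⟨ cong (λ r → ∑< r (λ t → g (w +F (t ⋆ a)))) p≡1+q ⟩
    ∑< (suc q) (λ t → g (w +F (t ⋆ a)))
      ≡⟨ ∑<-cong (suc q) (λ t t<1+q → sym (coeff-one t (g (w +F (t ⋆ a))) (≤-pred t<1+q))) ⟩
    ∑< (suc q) (λ t → coeff q t (g (w +F (t ⋆ a))))
      ≡⟨ sym (Δs-replicate a g q w) ⟩
    Δs (replicate q a) g w ∎
    where open ≡-Reasoning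

  -- E is affine when x ↦ E(x) - E(0) is additive, written E(x + y) - E(y) = E(x) - E(0).
  Affine : (F → F) → Set
  Affine E = ∀ x y → E (x +F y) - E y ≡ E x - E 0F

  second-differences⇒affine : ∀ E → (∀ x y → Δ y (Δ x E) 0F ≡ 0F) → Affine E
  second-differences⇒affine E vanish x y = begin
    E (x +F y) - E y                    ≡⟨ cong₂ (λ u v → E (x +F u) - E v) (sym (identityʳ y)) (sym (identityʳ y)) ⟩
    E (x +F (y +F 0F)) - E (y +F 0F)    ≡⟨ x∙y⁻¹≈ε⇒x≈y _ _ (vanish x y) ⟩
    E (x +F 0F) - E 0F                  ≡⟨ cong (λ u → E u - E 0F) (identityʳ x) ⟩
    E x - E 0F                          ∎
    where open ≡-Reasoning

  -- If d°(f) ≤ p then D̃_a f is affine: its second differences are the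
  -- (p+1)-st differences [f]^{p+1}(y, x, a, …, a) of f.
  D̃-affine : ∀ f → DegLe f p → ∀ a → Affine (D̃ f a)
  D̃-affine f deg a = second-differences⇒affine (D̃ f a) λ x y → begin
    Δ y (Δ x (D̃ f a)) 0F                   ≡⟨ Δ-cong y (Δ-cong x (D̃≡Δs f a)) 0F ⟩
    Δs (y ∷ x ∷ replicate q a) f 0F        ≡⟨ sym (bracket≡Δs f (suc (suc q)) (y ∷ x ∷ replicate q a)) ⟩
    bracket f (suc (suc q)) (y ∷ x ∷ replicate q a)
                                           ≡⟨ deg (suc (suc q)) (subst (_< suc (suc q)) (sym p≡1+q) (n<1+n (suc q))) _ ⟩
    0F                                     ∎
    where open ≡-Reasoning

  translation : Fp → Permutation p p
  translation c = permutation (_+ₚ c) (_+ₚ (-ₚ c)) (//-rightDividesˡ c) (//-rightDividesʳ c)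
    where open import Algebra.Properties.Group (AbelianGroup.group Fp-abelianGroup)
            using (//-rightDividesˡ; //-rightDividesʳ)

  sum-translate-Fp : ∀ (H : Fp → ℕ) c → sum (map (λ x → H (x +ₚ c)) (allFin p)) ≡ sum (map H (allFin p))
  sum-translate-Fp H c = begin
    sum (map (λ x → H (x +ₚ c)) (allFin p))  ≡⟨ foldr-allFin _+_ 0 p (λ x → H (x +ₚ c)) ⟩
    ℕ-∑.sum (λ x → H (x +ₚ c))              ≡⟨ sym (ℕ-∑.sum-permute H (translation c)) ⟩
    ℕ-∑.sum H                                ≡⟨ sym (foldr-allFin _+_ 0 p H) ⟩
    sum (map H (allFin p))                   ∎
    where
    open ≡-Reasoning
    module ℕ-∑ = Algebra.Properties.CommutativeMonoid.Sum +-0-commutativeMonoid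

  ∑Vecs : ∀ k → (Vec Fp k → ℕ) → ℕ
  ∑Vecs k h = sum (map h (allVecs k))

  ∑Vecs-suc : ∀ k h → ∑Vecs (suc k) h ≡ sum (map (λ x → ∑Vecs k (λ v → h (x ∷ v))) (allFin p))
  ∑Vecs-suc k h = begin
    sum (map h (concatMap (λ x → map (x ∷_) (allVecs k)) (allFin p)))
      ≡⟨ cong sum (Listₚ.map-concatMap h (λ x → map (x ∷_) (allVecs k)) (allFin p)) ⟩
    sum (concatMap (λ x → map h (map (x ∷_) (allVecs k))) (allFin p))
      ≡⟨ sum-concatMap _ (allFin p) ⟩
    sum (map (λ x → sum (map h (map (x ∷_) (allVecs k)))) (allFin p))
      ≡⟨ cong sum (Listₚ.map-cong (λ x → cong sum (sym (Listₚ.map-∘ (allVecs k)))) (allFin p)) ⟩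
    sum (map (λ x → ∑Vecs k (λ v → h (x ∷ v))) (allFin p)) ∎
    where open ≡-Reasoning

  ∑Vecs-translate : ∀ k h (c : Vec Fp k) → ∑Vecs k (λ v → h (zipWith _+ₚ_ v c)) ≡ ∑Vecs k h
  ∑Vecs-translate zero h [] = refl
  ∑Vecs-translate (suc k) h (c₀ ∷ c) = begin
    ∑Vecs (suc k) (λ v → h (zipWith _+ₚ_ v (c₀ ∷ c)))
      ≡⟨ ∑Vecs-suc k _ ⟩
    sum (map (λ x → ∑Vecs k (λ v → h ((x +ₚ c₀) ∷ zipWith _+ₚ_ v c))) (allFin p))
      ≡⟨ cong sum (Listₚ.map-cong (λ x → ∑Vecs-translate k (λ v → h ((x +ₚ c₀) ∷ v)) c) (allFin p)) ⟩
    sum (map (λ x → H (x +ₚ c₀)) (allFin p))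
      ≡⟨ sum-translate-Fp H c₀ ⟩
    sum (map H (allFin p))
      ≡⟨ sym (∑Vecs-suc k h) ⟩
    ∑Vecs (suc k) h ∎
    where
    open ≡-Reasoning
    H : Fp → ℕ
    H x = ∑Vecs k (λ v → h (x ∷ v))

  fibre : (F → F) → F → ℕ
  fibre E b = length (filter (λ x → E x ≟F b) allF)

  affine-fibres : ∀ E → Affine E → ∀ b → (fibre E b ≡ 0) ⊎ (fibre E b ≡ fibre E (E 0F))
  affine-fibres E affine b with any? (λ x → E x ≟F b) allF
  ... | no ∄x = inj₁ (cong length (filter-none (λ x → E x ≟F b) (¬Any⇒All¬ allF ∄x)))
  ... | yes ∃x with satisfied ∃x
  ...   | x₀ , Ex₀≡b = inj₂ (begin
    fibre E b
      ≡⟨ length-filter (λ x → E x ≟F b) allF ⟩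
    ∑Vecs n (λ x → indicator (does (E x ≟F b)))
      ≡⟨ sym (∑Vecs-translate n (λ x → indicator (does (E x ≟F b))) x₀) ⟩
    ∑Vecs n (λ x → indicator (does (E (x +F x₀) ≟F b)))
      ≡⟨ cong sum (Listₚ.map-cong (λ x → cong indicator (does-⇔ (same-fibre x) (E (x +F x₀) ≟F b) (E x ≟F E 0F))) allF) ⟩
    ∑Vecs n (λ x → indicator (does (E x ≟F E 0F)))
      ≡⟨ sym (length-filter (λ x → E x ≟F E 0F) allF) ⟩
    fibre E (E 0F) ∎)
    where
    open ≡-Reasoning
    -- E(x + x₀) - b = E(x + x₀) - E(x₀) = E(x) - E(0)
    same-fibre : ∀ x → (E (x +F x₀) ≡ b) ⇔ (E x ≡ E 0F)
    same-fibre x = mk⇔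
      (λ e → x∙y⁻¹≈ε⇒x≈y _ _ (trans (sym (affine x x₀)) (x≈y⇒x∙y⁻¹≈ε (trans e (sym Ex₀≡b)))))
      (λ e → trans (x∙y⁻¹≈ε⇒x≈y _ _ (trans (affine x x₀) (x≈y⇒x∙y⁻¹≈ε e))) Ex₀≡b)

proposition2p10 : (p : ℕ) (pr : Prime p) (n : ℕ) → 1 ≤ n →
    let open FF p pr n in
    (f : F → F) → ¬ IsZeroFun f → DegLe f p →
    ((a : F) → NonZeroF a → (b : F) →
        (Ñ f a b ≡ 0) ⊎ (Ñ f a b ≡ Ñ f a (D̃ f a 0F)))
    × (IsGAPN f ⇔ ((a : F) → NonZeroF a → Ñ f a (D̃ f a 0F) ≤ p))
proposition2p10 p pr n _ f _ deg = fibres , mk⇔ (λ gapn a a≢0 → gapn a a≢0 (D̃ f a 0F)) bounded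
  where
  open FF p pr n
  open Development p pr n using (affine-fibres; D̃-affine)
  -- Every fibre of the affine map D̃_a f is empty or of the size of the fibre over D̃_a f(0),
  fibres : (a : F) → NonZeroF a → (b : F) → (Ñ f a b ≡ 0) ⊎ (Ñ f a b ≡ Ñ f a (D̃ f a 0F))
  fibres a _ = affine-fibres (D̃ f a) (D̃-affine f deg a)
  -- so bounding the fibre over D̃_a f(0) bounds them all
  bounded : ((a : F) → NonZeroF a → Ñ f a (D̃ f a 0F) ≤ p) → IsGAPN f
  bounded h a a≢0 b with fibres a a≢0 b
  ... | inj₁ empty = subst (_≤ p) (sym empty) z≤n
  ... | inj₂ same = subst (_≤ p) (sym same) (h a a≢0)
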